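{- Let $G$ be a finite simple graph and let $X$ be an independent set of $G$ with $d(X)>0$ such that $d(Y)<d(X)$ for every proper subset $Y \subsetneq X$. Define the graph $H_X$ with vertex set $X \cup N(X) \cup \{v,w\}$, where $v,w$ are two new vertices not in $V(G)$, and edge set $\{xy \in E(G) : x\in X, y \in N(X)\} \cup \{vw\} \cup \{vx : x \in N(X)\}$. Then $\ker(H_X) = X$.
   Context: For a graph $H$ and $A \subseteq V(H)$, $N_H(A)$ is the set of vertices of $H$ adjacent to some vertex of $A$; $d_H(A)=|A|-|N_H(A)|$ (in $G$ written $N$, $d$). $d_c(H)=\max\{d_H(A): A\subseteq V(H)\}$; a set $A$ is critical if $d_H(A)=d_c(H)$, and $\ker(H)$ is the intersection of all critical sets of $H$. -}

module Defs where

open import Data.Nat using (ℕ; zero; suc)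
open import Data.Integer as ℤ using (ℤ; +_; _-_)
open import Data.Bool using (Bool; true; false; _∧_; _∨_)
open import Data.Bool.Properties using () renaming (_≟_ to _≟ᵇ_)
open import Data.Fin using (Fin; zero; suc)
open import Data.Fin.Properties using (any?)
open import Data.Fin.Subset using (Subset; _∈_; _⊆_; ∣_∣; _∪_; inside; outside)
open import Data.Fin.Subset.Properties using (_∈?_)
open import Data.Vec using (Vec; _∷_; lookup; tabulate)
open import Data.Product using (_×_)
open import Relation.Nullary using (does)
open import Relation.Nullary.Decidable using (_×-dec_)
open import Relation.Binary.PropositionalEquality using (_≡_)

record Graph (n : ℕ) : Set where
  field
    V   : Subset n
    adj : Fin n → Fin n → Bool
open Graph public

record IsSimple {n : ℕ} (G : Graph n) : Set where
  field
    sym     : ∀ x y → adj G x y ≡ adj G y x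
    irrefl  : ∀ x → adj G x x ≡ false
    closedV : ∀ x y → adj G x y ≡ true → x ∈ V G × y ∈ V G

N : ∀ {n} → Graph n → Subset n → Subset n
N G A = tabulate λ y → does (any? λ x → (x ∈? A) ×-dec (adj G x y ≟ᵇ true))

d : ∀ {n} → Graph n → Subset n → ℤ
d G A = + ∣ A ∣ - + ∣ N G A ∣

Independent : ∀ {n} → Graph n → Subset n → Set
Independent G A = ∀ x y → x ∈ A → y ∈ A → adj G x y ≡ false

Critical : ∀ {n} → Graph n → Subset n → Set
Critical H A = A ⊆ V H × (∀ B → B ⊆ V H → d H B ℤ.≤ d H A)

InKer : ∀ {n} → Graph n → Fin n → Set
InKer H u = u ∈ V H × (∀ A → Critical H A → u ∈ A)

-- The graph H_X on Fin (2 + n): vertex 0 is v, vertex 1 is w,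
-- vertex (suc (suc x)) is the old vertex x of G.
HXadj : ∀ {n} → Graph n → Subset n → Fin (suc (suc n)) → Fin (suc (suc n)) → Bool
HXadj G X zero zero = false
HXadj G X zero (suc zero) = true
HXadj G X (suc zero) zero = true
HXadj G X zero (suc (suc y)) = lookup (N G X) y
HXadj G X (suc (suc y)) zero = lookup (N G X) y
HXadj G X (suc zero) (suc zero) = false
HXadj G X (suc zero) (suc (suc y)) = false
HXadj G X (suc (suc y)) (suc zero) = false
HXadj G X (suc (suc a)) (suc (suc b)) =
  adj G a b ∧ ((lookup X a ∧ lookup (N G X) b) ∨ (lookup X b ∧ lookup (N G X) a))

HX : ∀ {n} → Graph n → Subset n → Graph (suc (suc n))
HX G X = record
  { V   = inside ∷ inside ∷ (X ∪ N G X)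
  ; adj = HXadj G X
  }

liftX : ∀ {n} → Subset n → Subset (suc (suc n))
liftX X = outside ∷ outside ∷ X

module Submission where

-- The lift L of X is critical in H_X and lies in every critical set.  Minimality of X
-- gives Hall's condition |S| ≤ |X ∩ N(S)| for S ⊆ N(X).  Take B ⊆ V(H_X) with trace
-- Y = B ∩ X.  The vertices of B in N(X) are paid for by their distinct neighbours in X,
-- which lie outside N(Y) ⊆ N(X); w ∈ B is paid for by v ∈ N(B); and if v ∈ B then all of
-- N(X) ⊆ N(B).  Hence d_H(B) ≤ d_G(Y) ≤ d_G(X) ≤ d_H(L), and the middle inequality is
-- strict unless X ⊆ B.

open import Defs
open import Data.Nat using (ℕ; suc)
open import Data.Integer using (+_; _<_)
open import Data.Fin using (Fin)
open import Data.Fin.Subset using (Subset; _⊆_; _⊂_; _∈_)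
open import Function.Bundles using (_⇔_)

open import Data.Bool using (true; _∧_)
open import Data.Bool.Properties using (∨-zeroʳ; ∧-conicalˡ)
open import Data.Empty using (⊥-elim)
open import Data.Fin using (zero; suc)
open import Data.Fin.Properties using (any?)
open import Data.Fin.Subset using (Side; inside; outside; ∣_∣; _∪_; _∩_; ∁; _∉_) renaming (⊥ to ∅)
open import Data.Fin.Subset.Properties
  using (_∈?_; drop-there; drop-∷-⊆; out⊂in; ⊆-refl; p⊆q⇒∣p∣≤∣q∣; ∣⊥∣≡0;
         p∩q⊆p; p∩q⊆q; x∈p∩q⁺; x∈p∩q⁻; x∈p∪q⁺; x∈p∪q⁻; x∉p⇒x∈∁p; x∈∁p⇒x∉p)
open import Data.Integer as ℤ using (_⊖_)
import Data.Integer.Properties as ℤ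
open import Data.Nat as ℕ using (_+_; _≤_; z≤n; s≤s)
import Data.Nat.Properties as ℕ
open import Data.Product using (_×_; _,_; ∃-syntax)
open import Data.Sum using (_⊎_; inj₁; inj₂)
open import Data.Vec using (_∷_; []; lookup; here; there)
open import Data.Vec.Properties using ([]=⇒lookup; lookup⇒[]=; lookup∘tabulate)
open import Function.Base using (_∘_)
open import Function.Bundles using (mk⇔)
open import Relation.Nullary using (Dec; yes; no; does)
open import Relation.Nullary.Decidable using (dec-true)
open import Relation.Binary.PropositionalEquality using (_≡_; refl; sym; trans; cong; cong₂; subst₂)

bit : Side → ℕ
bit inside  = 1
bit outside = 0

bit-mono : ∀ {x y} → (x ≡ inside → y ≡ inside) → bit x ≤ bit y
bit-mono {outside} _ = z≤n
bit-mono {inside} x⇒y rewrite x⇒y refl = ℕ.≤-refl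

∣x∷p∣≡bit+∣p∣ : ∀ {n} x (p : Subset n) → ∣ x ∷ p ∣ ≡ bit x + ∣ p ∣
∣x∷p∣≡bit+∣p∣ inside  p = refl
∣x∷p∣≡bit+∣p∣ outside p = refl

tail₂ : ∀ {n} → Subset (suc (suc n)) → Subset n
tail₂ (_ ∷ _ ∷ p) = p

∈tail₂ : ∀ {n} {x : Fin n} {p : Subset (suc (suc n))} → suc (suc x) ∈ p → x ∈ tail₂ p
∈tail₂ {p = _ ∷ _ ∷ p} = drop-there ∘ drop-there

bit+∣tail₂∣≤∣p∣ : ∀ {n} (p : Subset (suc (suc n))) → bit (lookup p zero) + ∣ tail₂ p ∣ ≤ ∣ p ∣
bit+∣tail₂∣≤∣p∣ (x ∷ y ∷ p) = ℕ.≤-trans (ℕ.+-monoʳ-≤ (bit x) (ℕ.m≤n+m ∣ p ∣ (bit y)))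
  (ℕ.≤-reflexive (sym (trans (∣x∷p∣≡bit+∣p∣ x (y ∷ p))
                              (cong (λ k → bit x + k) (∣x∷p∣≡bit+∣p∣ y p)))))

bit+suc∣tail₂∣≤∣p∣ : ∀ {n} (p : Subset (suc (suc n))) → suc zero ∈ p →
  bit (lookup p zero) + (suc ∣ tail₂ p ∣) ≤ ∣ p ∣
bit+suc∣tail₂∣≤∣p∣ (x ∷ inside ∷ p) (there here) =
  ℕ.≤-reflexive (sym (∣x∷p∣≡bit+∣p∣ x (inside ∷ p)))

∣p∪q∣+∣p∩q∣≡∣p∣+∣q∣ : ∀ {n} (p q : Subset n) → ∣ p ∪ q ∣ + ∣ p ∩ q ∣ ≡ ∣ p ∣ + ∣ q ∣
∣p∪q∣+∣p∩q∣≡∣p∣+∣q∣ [] [] = refl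
∣p∪q∣+∣p∩q∣≡∣p∣+∣q∣ (inside ∷ p) (inside ∷ q) = cong suc (begin
  ∣ p ∪ q ∣ + (suc ∣ p ∩ q ∣)  ≡⟨ ℕ.+-suc _ _ ⟩
  suc (∣ p ∪ q ∣ + ∣ p ∩ q ∣) ≡⟨ cong suc (∣p∪q∣+∣p∩q∣≡∣p∣+∣q∣ p q) ⟩
  suc (∣ p ∣ + ∣ q ∣)         ≡⟨ ℕ.+-suc _ _ ⟨
  ∣ p ∣ + (suc ∣ q ∣)         ∎)
  where open Relation.Binary.PropositionalEquality.≡-Reasoning
∣p∪q∣+∣p∩q∣≡∣p∣+∣q∣ (inside ∷ p) (outside ∷ q) = cong suc (∣p∪q∣+∣p∩q∣≡∣p∣+∣q∣ p q)
∣p∪q∣+∣p∩q∣≡∣p∣+∣q∣ (outside ∷ p) (inside ∷ q) =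
  trans (cong suc (∣p∪q∣+∣p∩q∣≡∣p∣+∣q∣ p q)) (sym (ℕ.+-suc _ _))
∣p∪q∣+∣p∩q∣≡∣p∣+∣q∣ (outside ∷ p) (outside ∷ q) = ∣p∪q∣+∣p∩q∣≡∣p∣+∣q∣ p q

p⊆q∪r⇒∣p∣≤∣q∣+∣r∣ : ∀ {n} {p q r : Subset n} → p ⊆ q ∪ r → ∣ p ∣ ≤ ∣ q ∣ + ∣ r ∣
p⊆q∪r⇒∣p∣≤∣q∣+∣r∣ {q = q} {r} p⊆q∪r = ℕ.≤-trans (p⊆q⇒∣p∣≤∣q∣ p⊆q∪r)
  (ℕ.≤-trans (ℕ.m≤m+n _ _) (ℕ.≤-reflexive (∣p∪q∣+∣p∩q∣≡∣p∣+∣q∣ q r)))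

disjoint⇒∣p∣+∣q∣≤∣r∣ : ∀ {n} {p q r : Subset n} → (∀ {x} → x ∈ p → x ∉ q) →
  p ⊆ r → q ⊆ r → ∣ p ∣ + ∣ q ∣ ≤ ∣ r ∣
disjoint⇒∣p∣+∣q∣≤∣r∣ {n} {p} {q} {r} disjoint p⊆r q⊆r = begin
  ∣ p ∣ + ∣ q ∣             ≡⟨ ∣p∪q∣+∣p∩q∣≡∣p∣+∣q∣ p q ⟨
  ∣ p ∪ q ∣ + ∣ p ∩ q ∣     ≡⟨ cong (λ k → ∣ p ∪ q ∣ + k) ∣p∩q∣≡0 ⟩
  ∣ p ∪ q ∣ + 0             ≡⟨ ℕ.+-identityʳ _ ⟩
  ∣ p ∪ q ∣                 ≤⟨ p⊆q⇒∣p∣≤∣q∣ p∪q⊆r ⟩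
  ∣ r ∣                     ∎
  where
  open ℕ.≤-Reasoning
  p∩q⊆∅ : p ∩ q ⊆ ∅
  p∩q⊆∅ x∈p∩q with x∈p∩q⁻ p q x∈p∩q
  ... | x∈p , x∈q = ⊥-elim (disjoint x∈p x∈q)
  ∣p∩q∣≡0 : ∣ p ∩ q ∣ ≡ 0
  ∣p∩q∣≡0 = ℕ.n≤0⇒n≡0 (ℕ.≤-trans (p⊆q⇒∣p∣≤∣q∣ p∩q⊆∅) (ℕ.≤-reflexive (∣⊥∣≡0 n)))
  p∪q⊆r : p ∪ q ⊆ r
  p∪q⊆r x∈p∪q with x∈p∪q⁻ p q x∈p∪q
  ... | inj₁ x∈p = p⊆r x∈p
  ... | inj₂ x∈q = q⊆r x∈q

⊆⇒⊂⊎≡ : ∀ {n} {p q : Subset n} → p ⊆ q → p ⊂ q ⊎ p ≡ q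
⊆⇒⊂⊎≡ {p = []} {[]} _ = inj₂ refl
⊆⇒⊂⊎≡ {p = x ∷ p} {y ∷ q} x∷p⊆y∷q with ⊆⇒⊂⊎≡ (drop-∷-⊆ x∷p⊆y∷q)
... | inj₁ (_ , v , v∈q , v∉p) = inj₁ (x∷p⊆y∷q , suc v , there v∈q , v∉p ∘ drop-there)
⊆⇒⊂⊎≡ {p = inside ∷ p} {inside ∷ q} _ | inj₂ refl = inj₂ refl
⊆⇒⊂⊎≡ {p = outside ∷ p} {outside ∷ q} _ | inj₂ refl = inj₂ refl
⊆⇒⊂⊎≡ {p = outside ∷ p} {inside ∷ q} _ | inj₂ refl = inj₁ (out⊂in ⊆-refl)
⊆⇒⊂⊎≡ {p = inside ∷ p} {outside ∷ q} x∷p⊆y∷q | inj₂ refl with x∷p⊆y∷q here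
... | ()

does⇒ : ∀ {P : Set} (P? : Dec P) → does P? ≡ true → P
does⇒ (yes p) _ = p
does⇒ (no _) ()

module _ {n} (G : Graph n) where

  ∈N⁻ : ∀ {A j} → j ∈ N G A → ∃[ i ] i ∈ A × adj G i j ≡ true
  ∈N⁻ {j = j} j∈NA = does⇒ (any? _) (trans (sym (lookup∘tabulate _ j)) ([]=⇒lookup j∈NA))

  ∈N⁺ : ∀ {A i j} → i ∈ A → adj G i j ≡ true → j ∈ N G A
  ∈N⁺ {A} {i} {j} i∈A ij =
    lookup⇒[]= j (N G A) (trans (lookup∘tabulate _ j) (dec-true (any? _) (i , i∈A , ij)))

  N-mono : ∀ {A B} → A ⊆ B → N G A ⊆ N G B
  N-mono A⊆B j∈NA with ∈N⁻ j∈NA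
  ... | i , i∈A , ij = ∈N⁺ (A⊆B i∈A) ij

  d≡⊖ : ∀ A → d G A ≡ ∣ A ∣ ⊖ ∣ N G A ∣
  d≡⊖ A = ℤ.[+m]-[+n]≡m⊖n ∣ A ∣ ∣ N G A ∣

⊖-mono : ∀ {a a′ b b′} → a ≤ a′ → b′ ≤ b → a ⊖ b ℤ.≤ a′ ⊖ b′
⊖-mono {b = b} a≤a′ b′≤b = ℤ.≤-trans (ℤ.⊖-monoˡ-≤ b a≤a′) (ℤ.⊖-monoʳ-≥-≤ _ b′≤b)

⊖-bound : ∀ {a b} c x y z → a ≤ c + (x + z) → c + (y + z) ≤ b → a ⊖ b ℤ.≤ x ⊖ y
⊖-bound {a} {b} c x y z a≤ ≤b = begin
  a ⊖ b                       ≤⟨ ⊖-mono a≤ ≤b ⟩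
  c + (x + z) ⊖ (c + (y + z)) ≡⟨ ℤ.+-cancelˡ-⊖ c _ _ ⟩
  x + z ⊖ (y + z)             ≡⟨ cong₂ _⊖_ (ℕ.+-comm x z) (ℕ.+-comm y z) ⟩
  z + x ⊖ (z + y)             ≡⟨ ℤ.+-cancelˡ-⊖ z x y ⟩
  x ⊖ y                       ∎
  where open ℤ.≤-Reasoning

m⊖n+[n+p]≡m+p : ∀ m n p → m ⊖ n ℤ.+ + (n + p) ≡ + (m + p)
m⊖n+[n+p]≡m+p m n p = begin
  m ⊖ n ℤ.+ + (n + p) ≡⟨ ℤ.distribˡ-⊖-+-pos (n + p) m n ⟩
  m + (n + p) ⊖ n     ≡⟨ cong (_⊖ n) m+[n+p]≡n+[m+p] ⟩
  n + (m + p) ⊖ n     ≡⟨ ℤ.⊖-≥ (ℕ.m≤m+n n _) ⟩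
  + (n + (m + p) ℕ.∸ n) ≡⟨ cong +_ (ℕ.m+n∸m≡n n _) ⟩
  + (m + p)           ∎
  where
  open Relation.Binary.PropositionalEquality.≡-Reasoning
  m+[n+p]≡n+[m+p] : m + (n + p) ≡ n + (m + p)
  m+[n+p]≡n+[m+p] = trans (sym (ℕ.+-assoc m n p))
    (trans (cong (_+ p) (ℕ.+-comm m n)) (ℕ.+-assoc n m p))

⊖≤⊖⇒+≤+ : ∀ m n o p → m ⊖ n ℤ.≤ o ⊖ p → m + p ≤ o + n
⊖≤⊖⇒+≤+ m n o p le = ℤ.drop‿+≤+ (begin
  + (m + p)           ≡⟨ m⊖n+[n+p]≡m+p m n p ⟨
  m ⊖ n ℤ.+ + (n + p) ≤⟨ ℤ.+-monoˡ-≤ (+ (n + p)) le ⟩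
  o ⊖ p ℤ.+ + (n + p) ≡⟨ cong (λ k → o ⊖ p ℤ.+ + k) (ℕ.+-comm n p) ⟩
  o ⊖ p ℤ.+ + (p + n) ≡⟨ m⊖n+[n+p]≡m+p o p n ⟩
  + (o + n)           ∎)
  where open ℤ.≤-Reasoning

module Kernel {n} (G : Graph n) (X : Subset n)
  (adj-sym : ∀ x y → adj G x y ≡ adj G y x)
  (independent : Independent G X)
  (minimal : ∀ Y → Y ⊂ X → d G Y < d G X) where

  H : Graph (suc (suc n))
  H = HX G X

  L : Subset (suc (suc n))
  L = liftX X

  N[X]∉X : ∀ {y} → y ∈ N G X → y ∉ X
  N[X]∉X y∈NX y∈X with ∈N⁻ G y∈NX
  ... | x , x∈X , xy with trans (sym xy) (independent x _ x∈X y∈X)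
  ... | ()

  d≤d[X] : ∀ {Y} → Y ⊆ X → d G Y ℤ.≤ d G X
  d≤d[X] Y⊆X with ⊆⇒⊂⊎≡ Y⊆X
  ... | inj₁ Y⊂X = ℤ.<⇒≤ (minimal _ Y⊂X)
  ... | inj₂ refl = ℤ.≤-refl

  -- Removing N(S) from X costs |X ∩ N(S)| vertices but at least |S| neighbours.
  hall-condition : ∀ {S} → S ⊆ N G X → ∣ S ∣ ≤ ∣ X ∩ N G S ∣
  hall-condition {S} S⊆NX = ℕ.+-cancelˡ-≤ (∣ Y ∣ + ∣ N G Y ∣) _ _ (begin
    ∣ Y ∣ + ∣ N G Y ∣ + ∣ S ∣           ≡⟨ ℕ.+-assoc ∣ Y ∣ _ _ ⟩
    ∣ Y ∣ + (∣ N G Y ∣ + ∣ S ∣)         ≤⟨ ℕ.+-monoʳ-≤ ∣ Y ∣ ∣NY∣+∣S∣≤∣NX∣ ⟩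
    ∣ Y ∣ + ∣ N G X ∣                   ≤⟨ ⊖≤⊖⇒+≤+ (∣ Y ∣) (∣ N G Y ∣) _ _ d[Y]≤d[X] ⟩
    ∣ X ∣ + ∣ N G Y ∣                   ≤⟨ ℕ.+-monoˡ-≤ ∣ N G Y ∣ ∣X∣≤∣Y∣+∣X∩NS∣ ⟩
    ∣ Y ∣ + ∣ X ∩ N G S ∣ + ∣ N G Y ∣   ≡⟨ ℕ.+-assoc ∣ Y ∣ _ _ ⟩
    ∣ Y ∣ + (∣ X ∩ N G S ∣ + ∣ N G Y ∣) ≡⟨ cong (λ k → ∣ Y ∣ + k) (ℕ.+-comm _ ∣ N G Y ∣) ⟩
    ∣ Y ∣ + (∣ N G Y ∣ + ∣ X ∩ N G S ∣) ≡⟨ ℕ.+-assoc ∣ Y ∣ _ _ ⟨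
    ∣ Y ∣ + ∣ N G Y ∣ + ∣ X ∩ N G S ∣   ∎)
    where
    open ℕ.≤-Reasoning
    Y : Subset n
    Y = X ∩ ∁ (N G S)
    d[Y]≤d[X] : ∣ Y ∣ ⊖ ∣ N G Y ∣ ℤ.≤ ∣ X ∣ ⊖ ∣ N G X ∣
    d[Y]≤d[X] = subst₂ ℤ._≤_ (d≡⊖ G Y) (d≡⊖ G X) (d≤d[X] (p∩q⊆p X _))
    N[Y]∩S≡∅ : ∀ {y} → y ∈ N G Y → y ∉ S
    N[Y]∩S≡∅ y∈NY y∈S with ∈N⁻ G y∈NY
    ... | x , x∈Y , xy = x∈∁p⇒x∉p (p∩q⊆q X _ x∈Y) (∈N⁺ G y∈S (trans (adj-sym _ x) xy))
    ∣NY∣+∣S∣≤∣NX∣ : ∣ N G Y ∣ + ∣ S ∣ ≤ ∣ N G X ∣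
    ∣NY∣+∣S∣≤∣NX∣ = disjoint⇒∣p∣+∣q∣≤∣r∣ N[Y]∩S≡∅ (N-mono G (p∩q⊆p X _)) S⊆NX
    X⊆Y∪[X∩NS] : X ⊆ Y ∪ (X ∩ N G S)
    X⊆Y∪[X∩NS] {x} x∈X with x ∈? N G S
    ... | yes x∈NS = x∈p∪q⁺ (inj₂ (x∈p∩q⁺ (x∈X , x∈NS)))
    ... | no x∉NS = x∈p∪q⁺ (inj₁ (x∈p∩q⁺ (x∈X , x∉p⇒x∈∁p x∉NS)))
    ∣X∣≤∣Y∣+∣X∩NS∣ : ∣ X ∣ ≤ ∣ Y ∣ + ∣ X ∩ N G S ∣
    ∣X∣≤∣Y∣+∣X∩NS∣ = p⊆q∪r⇒∣p∣≤∣q∣+∣r∣ X⊆Y∪[X∩NS]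

  H-edge-X-N[X] : ∀ {a b} → a ∈ X → b ∈ N G X → adj G a b ≡ true →
    adj H (suc (suc a)) (suc (suc b)) ≡ true
  H-edge-X-N[X] a∈X b∈NX ab rewrite ab | []=⇒lookup a∈X | []=⇒lookup b∈NX = refl

  H-edge-N[X]-X : ∀ {a b} → a ∈ N G X → b ∈ X → adj G a b ≡ true →
    adj H (suc (suc a)) (suc (suc b)) ≡ true
  H-edge-N[X]-X {a} {b} a∈NX b∈X ab rewrite ab | []=⇒lookup a∈NX | []=⇒lookup b∈X =
    ∨-zeroʳ (lookup X a ∧ lookup (N G X) b)

  module _ (b₀ b₁ : Side) (B′ : Subset n) where

    private
      B : Subset (suc (suc n))
      B = b₀ ∷ b₁ ∷ B′

    N[B′∩X]⊆N[B] : N G (B′ ∩ X) ⊆ tail₂ (N H B)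
    N[B′∩X]⊆N[B] y∈N with ∈N⁻ G y∈N
    ... | x , x∈B′∩X , xy with x∈p∩q⁻ B′ X x∈B′∩X
    ... | x∈B′ , x∈X = ∈tail₂ {p = N H B}
      (∈N⁺ H {A = B} (there (there x∈B′)) (H-edge-X-N[X] x∈X (∈N⁺ G x∈X xy) xy))

    X∩N[B′∩N[X]]⊆N[B] : X ∩ N G (B′ ∩ N G X) ⊆ tail₂ (N H B)
    X∩N[B′∩N[X]]⊆N[B] {y} y∈X∩N with x∈p∩q⁻ X _ y∈X∩N
    ... | y∈X , y∈N with ∈N⁻ G y∈N
    ... | x , x∈B′∩NX , xy with x∈p∩q⁻ B′ (N G X) x∈B′∩NX
    ... | x∈B′ , x∈NX = ∈tail₂ {p = N H B}
      (∈N⁺ H {A = B} (there (there x∈B′)) (H-edge-N[X]-X x∈NX y∈X xy))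

    -- The neighbours of B′ ∩ N(X) in X avoid Z ⊆ N(X); Hall's condition counts them.
    ∣Z∣+∣B′∩N[X]∣≤∣N[B]∣ : ∀ {Z} → Z ⊆ N G X → Z ⊆ tail₂ (N H B) →
      ∣ Z ∣ + ∣ B′ ∩ N G X ∣ ≤ ∣ tail₂ (N H B) ∣
    ∣Z∣+∣B′∩N[X]∣≤∣N[B]∣ {Z} Z⊆NX Z⊆N[B] = ℕ.≤-trans
      (ℕ.+-monoʳ-≤ ∣ Z ∣ (hall-condition (p∩q⊆q B′ (N G X))))
      (disjoint⇒∣p∣+∣q∣≤∣r∣ (λ z∈Z z∈X∩N → N[X]∉X (Z⊆NX z∈Z) (p∩q⊆p X _ z∈X∩N))
        Z⊆N[B] X∩N[B′∩N[X]]⊆N[B])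

    ∣w∷B′∣≤ : B′ ⊆ X ∪ N G X →
      ∣ b₁ ∷ B′ ∣ ≤ bit (lookup (N H B) zero) + (∣ B′ ∩ X ∣ + ∣ B′ ∩ N G X ∣)
    ∣w∷B′∣≤ B′⊆X∪NX = ℕ.≤-trans (ℕ.≤-reflexive (∣x∷p∣≡bit+∣p∣ b₁ B′))
      (ℕ.+-mono-≤ (bit-mono w∈B⇒v∈N[B]) (p⊆q∪r⇒∣p∣≤∣q∣+∣r∣ B′⊆B′∩X∪B′∩NX))
      where
      w∈B⇒v∈N[B] : b₁ ≡ inside → lookup (N H B) zero ≡ inside
      w∈B⇒v∈N[B] b₁≡inside =
        []=⇒lookup (∈N⁺ H {A = B} {j = zero} (lookup⇒[]= (suc zero) B b₁≡inside) refl)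
      B′⊆B′∩X∪B′∩NX : B′ ⊆ (B′ ∩ X) ∪ (B′ ∩ N G X)
      B′⊆B′∩X∪B′∩NX x∈B′ with x∈p∪q⁻ X (N G X) (B′⊆X∪NX x∈B′)
      ... | inj₁ x∈X = x∈p∪q⁺ (inj₁ (x∈p∩q⁺ (x∈B′ , x∈X)))
      ... | inj₂ x∈NX = x∈p∪q⁺ (inj₂ (x∈p∩q⁺ (x∈B′ , x∈NX)))

  d[B]≤d[B∩X] : ∀ B → B ⊆ V H → d H B ℤ.≤ d G (tail₂ B ∩ X)
  d[B]≤d[B∩X] B@(outside ∷ b₁ ∷ B′) B⊆VH = begin
    d H B              ≡⟨ d≡⊖ H B ⟩
    ∣ B ∣ ⊖ ∣ N H B ∣   ≤⟨ ⊖-bound (bit (lookup (N H B) zero)) (∣ Y ∣) (∣ N G Y ∣) (∣ B′ ∩ N G X ∣)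
                            (∣w∷B′∣≤ outside b₁ B′ (drop-∷-⊆ (drop-∷-⊆ B⊆VH))) ∣N[B]∣≥ ⟩
    ∣ Y ∣ ⊖ ∣ N G Y ∣   ≡⟨ d≡⊖ G Y ⟨
    d G Y              ∎
    where
    open ℤ.≤-Reasoning
    Y = B′ ∩ X
    ∣N[B]∣≥ : bit (lookup (N H B) zero) + (∣ N G Y ∣ + ∣ B′ ∩ N G X ∣) ≤ ∣ N H B ∣
    ∣N[B]∣≥ = ℕ.≤-trans
      (ℕ.+-monoʳ-≤ (bit (lookup (N H B) zero))
        (∣Z∣+∣B′∩N[X]∣≤∣N[B]∣ outside b₁ B′ (N-mono G (p∩q⊆q B′ X)) (N[B′∩X]⊆N[B] outside b₁ B′)))
      (bit+∣tail₂∣≤∣p∣ (N H B))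
  d[B]≤d[B∩X] B@(inside ∷ b₁ ∷ B′) B⊆VH = begin
    d H B              ≡⟨ d≡⊖ H B ⟩
    ∣ B ∣ ⊖ ∣ N H B ∣   ≤⟨ ⊖-bound (suc (bit (lookup (N H B) zero))) (∣ Y ∣) (∣ N G X ∣) (∣ B′ ∩ N G X ∣)
                            (s≤s (∣w∷B′∣≤ inside b₁ B′ (drop-∷-⊆ (drop-∷-⊆ B⊆VH)))) ∣N[B]∣≥ ⟩
    ∣ Y ∣ ⊖ ∣ N G X ∣   ≤⟨ ℤ.⊖-monoʳ-≥-≤ ∣ Y ∣ (p⊆q⇒∣p∣≤∣q∣ (N-mono G (p∩q⊆q B′ X))) ⟩
    ∣ Y ∣ ⊖ ∣ N G Y ∣   ≡⟨ d≡⊖ G Y ⟨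
    d G Y              ∎
    where
    open ℤ.≤-Reasoning
    Y = B′ ∩ X
    N[X]⊆N[B] : N G X ⊆ tail₂ (N H B)
    N[X]⊆N[B] y∈NX = ∈tail₂ {p = N H B} (∈N⁺ H {A = B} here ([]=⇒lookup y∈NX))
    ∣N[B]∣≥ : suc (bit (lookup (N H B) zero)) + (∣ N G X ∣ + ∣ B′ ∩ N G X ∣) ≤ ∣ N H B ∣
    ∣N[B]∣≥ = ℕ.≤-trans
      (ℕ.≤-reflexive (sym (ℕ.+-suc (bit (lookup (N H B) zero)) _)))
      (ℕ.≤-trans
        (ℕ.+-monoʳ-≤ (bit (lookup (N H B) zero))
          (s≤s (∣Z∣+∣B′∩N[X]∣≤∣N[B]∣ inside b₁ B′ ⊆-refl N[X]⊆N[B])))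
        (bit+suc∣tail₂∣≤∣p∣ (N H B) (∈N⁺ H {A = B} {j = suc zero} here refl)))

  N[L]⊆liftX[N[X]] : N H L ⊆ liftX (N G X)
  N[L]⊆liftX[N[X]] u∈N with ∈N⁻ H {A = L} u∈N
  ... | suc (suc x) , there (there x∈X) , xu = edge _ xu
    where
    edge : ∀ u → adj H (suc (suc x)) u ≡ true → u ∈ liftX (N G X)
    edge zero xv = ⊥-elim (N[X]∉X (lookup⇒[]= x (N G X) xv) x∈X)
    edge (suc (suc y)) xy = there (there (∈N⁺ G x∈X (∧-conicalˡ _ _ xy)))

  L⊆V : L ⊆ V H
  L⊆V {suc (suc x)} (there (there x∈X)) = there (there (x∈p∪q⁺ (inj₁ x∈X)))

  d[X]≤d[L] : d G X ℤ.≤ d H L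
  d[X]≤d[L] = begin
    d G X             ≡⟨ d≡⊖ G X ⟩
    ∣ X ∣ ⊖ ∣ N G X ∣  ≤⟨ ℤ.⊖-monoʳ-≥-≤ ∣ X ∣ (p⊆q⇒∣p∣≤∣q∣ N[L]⊆liftX[N[X]]) ⟩
    ∣ L ∣ ⊖ ∣ N H L ∣  ≡⟨ d≡⊖ H L ⟨
    d H L             ∎
    where open ℤ.≤-Reasoning

  L-critical : Critical H L
  L-critical = L⊆V , λ B B⊆VH →
    ℤ.≤-trans (d[B]≤d[B∩X] B B⊆VH) (ℤ.≤-trans (d≤d[X] (p∩q⊆q _ X)) d[X]≤d[L])

  critical⇒L⊆ : ∀ {A} → Critical H A → L ⊆ A
  critical⇒L⊆ {a₀ ∷ a₁ ∷ A′} (A⊆VH , A-max) {suc (suc x)} (there (there x∈X)) with x ∈? A′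
  ... | yes x∈A′ = there (there x∈A′)
  ... | no x∉A′ = ⊥-elim (ℤ.<-irrefl refl (begin-strict
    d H L          ≤⟨ A-max L L⊆V ⟩
    d H A          ≤⟨ d[B]≤d[B∩X] A A⊆VH ⟩
    d G (A′ ∩ X)   <⟨ minimal _ (p∩q⊆q A′ X , x , x∈X , x∉A′ ∘ p∩q⊆p A′ X) ⟩
    d G X          ≤⟨ d[X]≤d[L] ⟩
    d H L          ∎))
    where
    open ℤ.≤-Reasoning
    A = a₀ ∷ a₁ ∷ A′

theorem2p7 : ∀ {n : ℕ} (G : Graph n) (X : Subset n) →
    IsSimple G → X ⊆ V G → Independent G X →
    + 0 < d G X →
    (∀ Y → Y ⊂ X → d G Y < d G X) →
    ∀ (u : Fin (suc (suc n))) → InKer (HX G X) u ⇔ u ∈ liftX X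
theorem2p7 G X simple _ independent _ minimal u = mk⇔
  (λ (_ , in-every-critical) → in-every-critical L L-critical)
  (λ u∈L → L⊆V u∈L , λ _ A-critical → critical⇒L⊆ A-critical u∈L)
  where open Kernel G X (IsSimple.sym simple) independent minimal
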